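{- Let $x$ be any of strict, strict \& simple, non-strict, non-strict \& simple, proper, proper \& simple. Then (a) every undirected temporal graph in the setting UD \& $x$ has a reachability equivalent directed temporal graph in the setting D \& $x$; and (b) there is a directed temporal graph in the setting D \& $x$ that has no reachability equivalent undirected temporal graph in the setting UD \& $x$.
   Context: A directed (resp. undirected) temporal graph is a triple $(V,E,\lambda)$ with $V$ finite, $E$ a set of arcs $(u,v)$, $u\ne v$ (resp. 2-element subsets of $V$), and $\lambda$ assigning each (arc or edge) a nonempty finite set of time labels; it is simple if every edge has exactly one label, and proper if no two distinct edges incident to a common vertex share a label. A temporal path from $u$ to $v$ is a sequence $(e_1,t_1),\dots,(e_k,t_k)$, $k\ge1$, $t_i\in\lambda(e_i)$, with $e_1,\dots,e_k$ a path from $u$ to $v$ in the footprint $(V,E)$ (distinct vertices, respecting arc directions in the directed case) and $t_1\le\dots\le t_k$; it is strict if $t_1<\dots<t_k$. Setting "strict" uses strict paths for reachability, "non-strict" all temporal paths, "\& simple" restricts to simple graphs, "proper" consists of proper graphs (where strict and non-strict coincide). The reachability graph is the static directed graph on $V$ with arc $(u,v)$, $u\ne v$, iff there is a temporal path of the setting's kind from $u$ to $v$. Two temporal graphs are reachability equivalent if they have the same vertex set and isomorphic reachability graphs (each computed in its own setting). -}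

module Defs where

open import Data.Nat using (ℕ; zero; suc; _≤_; _<_)
open import Data.Fin using (Fin; inject₁; fromℕ) renaming (_<_ to _<ᶠ_)
open import Data.List using (List; [])
open import Data.List.Membership.Propositional using (_∈_)
open import Data.Product using (Σ; ∃; _×_; _,_)
open import Data.Sum using (_⊎_)
open import Data.Empty using (⊥)
open import Function.Definitions using (Injective)
open import Function.Bundles using (_↔_; _⇔_; Inverse)
open import Relation.Binary.PropositionalEquality using (_≡_; _≢_)
open import Relation.Nullary using (¬_)

-- A temporal graph on the vertex set V = Fin n is given by a labelling
-- lab u v : List ℕ, read as a finite set of time labels (membership ∈).
-- The pair (u,v) is an arc / edge of the footprint iff lab u v is nonempty;
-- so every edge carries a nonempty finite label set.
Labelling : ℕ → Set
Labelling n = Fin n → Fin n → List ℕ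

record DTG (n : ℕ) : Set where
  field
    lab     : Labelling n
    noLoops : ∀ u → lab u u ≡ []
open DTG public

record UTG (n : ℕ) : Set where
  field
    lab     : Labelling n
    noLoops : ∀ u → lab u u ≡ []
    symm    : ∀ u v → lab u v ≡ lab v u
open UTG public

-- Temporal path (of k+1 ≥ 1 edges) from u to v w.r.t. a labelling:
-- vertices vs 0 … vs (k+1), pairwise distinct; edge i goes from
-- vs i to vs (i+1) with time ts i ∈ lab (vs i) (vs (i+1)); the times are
-- non-decreasing (strict = false) or increasing (strict = true).
data Strictness : Set where
  strictPaths nonStrictPaths : Strictness

TimeOrder : Strictness → ℕ → ℕ → Set
TimeOrder strictPaths    s t = s < t
TimeOrder nonStrictPaths s t = s ≤ t

record TemporalPath {n : ℕ} (σ : Strictness) (lab : Labelling n) (u v : Fin n) : Set where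
  field
    k       : ℕ
    verts   : Fin (suc (suc k)) → Fin n
    times   : Fin (suc k) → ℕ
    distinct : Injective _≡_ _≡_ verts
    start   : verts Data.Fin.zero ≡ u
    end     : verts (fromℕ (suc k)) ≡ v
    labelled : ∀ i → times i ∈ lab (verts (inject₁ i)) (verts (Data.Fin.suc i))
    ordered : ∀ i j → i <ᶠ j → TimeOrder σ (times i) (times j)

data Setting : Set where
  strict strictSimple nonStrict nonStrictSimple proper properSimple : Setting

-- Which kind of temporal path a setting uses (in proper graphs strict and
-- non-strict coincide; we use strict paths).
pathKind : Setting → Strictness
pathKind strict          = strictPaths
pathKind strictSimple    = strictPaths
pathKind nonStrict       = nonStrictPaths
pathKind nonStrictSimple = nonStrictPaths
pathKind proper          = strictPaths
pathKind properSimple    = strictPaths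

IsSimple : ∀ {n} → Labelling n → Set
IsSimple {n} lab = ∀ (u v : Fin n) (s t : ℕ) → s ∈ lab u v → t ∈ lab u v → s ≡ t

ShareVertex : ∀ {n} → Fin n → Fin n → Fin n → Fin n → Set
ShareVertex a b c d = (a ≡ c) ⊎ (a ≡ d) ⊎ (b ≡ c) ⊎ (b ≡ d)

IsProperD : ∀ {n} → Labelling n → Set
IsProperD {n} lab = ∀ (a b c d : Fin n) (t : ℕ) → t ∈ lab a b → t ∈ lab c d →
  ShareVertex a b c d → ¬ (a ≡ c × b ≡ d) → ⊥

IsProperU : ∀ {n} → Labelling n → Set
IsProperU {n} lab = ∀ (a b c d : Fin n) (t : ℕ) → t ∈ lab a b → t ∈ lab c d →
  ShareVertex a b c d → ¬ ((a ≡ c × b ≡ d) ⊎ (a ≡ d × b ≡ c)) → ⊥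

record Unit : Set where

InSettingD : ∀ {n} → Setting → DTG n → Set
InSettingD strict          G = Unit
InSettingD strictSimple    G = IsSimple (lab G)
InSettingD nonStrict       G = Unit
InSettingD nonStrictSimple G = IsSimple (lab G)
InSettingD proper          G = IsProperD (lab G)
InSettingD properSimple    G = IsProperD (lab G) × IsSimple (lab G)

InSettingU : ∀ {n} → Setting → UTG n → Set
InSettingU strict          G = Unit
InSettingU strictSimple    G = IsSimple (lab G)
InSettingU nonStrict       G = Unit
InSettingU nonStrictSimple G = IsSimple (lab G)
InSettingU proper          G = IsProperU (lab G)
InSettingU properSimple    G = IsProperU (lab G) × IsSimple (lab G)

ReachD : ∀ {n} → Setting → DTG n → Fin n → Fin n → Set
ReachD x G u v = (u ≢ v) × TemporalPath (pathKind x) (lab G) u v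

ReachU : ∀ {n} → Setting → UTG n → Fin n → Fin n → Set
ReachU x G u v = (u ≢ v) × TemporalPath (pathKind x) (lab G) u v

Isomorphic : ∀ {n} → (Fin n → Fin n → Set) → (Fin n → Fin n → Set) → Set
Isomorphic {n} R S = Σ (Fin n ↔ Fin n) λ f →
  ∀ u v → R u v ⇔ S (Inverse.to f u) (Inverse.to f v)

ReachEquiv : ∀ {n} → Setting → UTG n → DTG n → Set
ReachEquiv x G D = Isomorphic (ReachU x G) (ReachD x D)

-- For (a) the settings without properness take the undirected graph itself as a
-- symmetric directed one. In the proper settings the two arcs of an edge would share
-- its label, so the arc a → b gets label 2t or 2t + 1 according to the orientation
-- of (a, b): a temporal path keeps its vertices and becomes strict, and conversely a
-- strict path of the oriented graph decodes to a non-decreasing path of the original,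
-- which is strict because consecutive edges of a proper graph carry distinct labels.
-- For (b), a single arc 0 → 1 has an asymmetric reachability graph, whereas on two
-- vertices every undirected reachability graph is symmetric.
module Submission where

open import Defs
open import Data.Bool using (Bool; true; false)
open import Data.Nat using (ℕ; zero; suc; pred; _≤_; _<_; z≤n; s≤s)
open import Data.Nat.Properties using (≤-refl; ≤∧≢⇒<; ≤-<-trans)
open import Data.Fin using (Fin; inject₁) renaming (zero to 0F; suc to sucF; _≤_ to _≤ᶠ_; _<_ to _<ᶠ_)
open import Data.Fin.Properties using (_≟_; _<?_; <-cmp; <⇒≢; <-trans; <⇒≤pred; ≤̄⇒inject₁<) renaming (≤-refl to ≤ᶠ-refl; ≤∧≢⇒< to ≤∧≢⇒<ᶠ)
open import Data.List using (_∷_; []; map)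
open import Data.List.Membership.Propositional using (_∈_)
open import Data.List.Membership.Propositional.Properties using (∈-map⁺; ∈-map⁻)
open import Data.List.Relation.Unary.Any using (here; there)
open import Data.Product using (Σ; _×_; _,_; proj₁; proj₂)
open import Data.Sum using (_⊎_; inj₁; inj₂)
open import Function using (_∘′_; case_of_)
open import Function.Bundles using (_⇔_; Inverse; Equivalence; mk⇔)
open import Function.Construct.Identity using (↔-id; ⇔-id)
open import Relation.Binary using (Symmetric; tri<; tri≈; tri>)
open import Relation.Binary.PropositionalEquality using (_≡_; _≢_; refl; sym; trans; cong; subst; subst₂)
open import Relation.Nullary using (¬_; does; yes; no; contradiction)
open import Relation.Nullary.Decidable using (dec-true; dec-false)

tagged : ℕ → Bool → ℕ
tagged zero    false = 0
tagged zero    true  = 1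
tagged (suc t) b     = suc (suc (tagged t b))

tagged-injective : ∀ {s t b c} → tagged s b ≡ tagged t c → s ≡ t × b ≡ c
tagged-injective {zero}  {zero}  {false} {false} _ = refl , refl
tagged-injective {zero}  {zero}  {true}  {true}  _ = refl , refl
tagged-injective {suc s} {suc t} e with tagged-injective {s} {t} (cong (pred ∘′ pred) e)
... | refl , b≡c = refl , b≡c
tagged-injective {zero}  {zero}  {false} {true}  ()
tagged-injective {zero}  {zero}  {true}  {false} ()
tagged-injective {zero}  {suc _} {false} ()
tagged-injective {zero}  {suc _} {true}  ()
tagged-injective {suc _} {zero}  {_}     {false} ()
tagged-injective {suc _} {zero}  {_}     {true}  ()

tagged-mono-< : ∀ {s t} b c → s < t → tagged s b < tagged t c
tagged-mono-< {zero}  false _ (s≤s _) = s≤s z≤n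
tagged-mono-< {zero}  true  _ (s≤s _) = s≤s (s≤s z≤n)
tagged-mono-< {suc _} b     c (s≤s s<t) = s≤s (s≤s (tagged-mono-< b c s<t))

tagged-cancel-< : ∀ {s t} b c → tagged s b < tagged t c → s ≤ t
tagged-cancel-< {zero}          _ _     _              = z≤n
tagged-cancel-< {suc _} {zero}  _ false ()
tagged-cancel-< {suc _} {zero}  _ true  (s≤s ())
tagged-cancel-< {suc _} {suc _} b c     (s≤s (s≤s lt)) = s≤s (tagged-cancel-< b c lt)

orientation : ∀ {n} → Fin n → Fin n → Bool
orientation a b = does (a <? b)

orientation-antisym : ∀ {n} {a b : Fin n} → a ≢ b → orientation a b ≢ orientation b a
orientation-antisym {a = a} {b} a≢b with <-cmp a b
... | tri< a<b _ b≮a rewrite dec-true (a <? b) a<b | dec-false (b <? a) b≮a = λ ()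
... | tri≈ _ a≡b _   = contradiction a≡b a≢b
... | tri> a≮b _ b<a rewrite dec-false (a <? b) a≮b | dec-true (b <? a) b<a = λ ()

orientLabels : ∀ {n} → Labelling n → Labelling n
orientLabels lab a b = map (λ t → tagged t (orientation a b)) (lab a b)

orientLabels-proper : ∀ {n} {lab : Labelling n} → IsProperU lab → IsProperD (orientLabels lab)
orientLabels-proper properLab a b c d _ t∈ab t∈cd shared distinctArcs
  with ∈-map⁻ _ t∈ab | ∈-map⁻ _ t∈cd
... | s , s∈ab , refl | s′ , s′∈cd , e with tagged-injective e
... | refl , sameOrientation = properLab a b c d s s∈ab s′∈cd shared sameEdge⇒sameArc
  where
    sameEdge⇒sameArc : ¬ ((a ≡ c × b ≡ d) ⊎ (a ≡ d × b ≡ c))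
    sameEdge⇒sameArc (inj₁ sameArc) = distinctArcs sameArc
    sameEdge⇒sameArc (inj₂ (refl , refl)) with a ≟ b
    ... | yes refl = distinctArcs (refl , refl)
    ... | no a≢b   = orientation-antisym a≢b sameOrientation

orientLabels-simple : ∀ {n} {lab : Labelling n} → IsSimple lab → IsSimple (orientLabels lab)
orientLabels-simple simple u v _ _ s∈ t∈ with ∈-map⁻ _ s∈ | ∈-map⁻ _ t∈
... | s , s∈uv , refl | t , t∈uv , refl = cong _ (simple u v s t s∈uv t∈uv)

nondecreasing-≤ : ∀ {k} (f : Fin k → ℕ) → (∀ i j → i <ᶠ j → f i ≤ f j) → ∀ {i j} → i ≤ᶠ j → f i ≤ f j
nondecreasing-≤ f mono {i} {j} i≤j with i ≟ j
... | yes refl = ≤-refl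
... | no i≢j   = mono i j (≤∧≢⇒<ᶠ i≤j i≢j)

nondecreasing⇒increasing : ∀ {k} (f : Fin (suc k) → ℕ) → (∀ i j → i <ᶠ j → f i ≤ f j) →
  (∀ m → f (inject₁ m) ≢ f (sucF m)) → ∀ i j → i <ᶠ j → f i < f j
nondecreasing⇒increasing f mono steps i (sucF m) i<j =
  ≤-<-trans (nondecreasing-≤ f mono (<⇒≤pred i<j))
            (≤∧≢⇒< (mono (inject₁ m) (sucF m) (≤̄⇒inject₁< ≤ᶠ-refl)) (steps m))

retime : ∀ {n σ σ′} {lab lab′ : Labelling n} {u v} (P : TemporalPath σ lab u v) →
  let open TemporalPath P in
  (ts : Fin (suc k) → ℕ) → (∀ i → ts i ∈ lab′ (verts (inject₁ i)) (verts (sucF i))) →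
  (∀ i j → i <ᶠ j → TimeOrder σ′ (ts i) (ts j)) → TemporalPath σ′ lab′ u v
retime P ts ts-labelled ts-ordered = record
  { k = k ; verts = verts ; times = ts ; distinct = distinct ; start = start ; end = end
  ; labelled = ts-labelled ; ordered = ts-ordered }
  where open TemporalPath P

module _ {n} {lab : Labelling n} {u v : Fin n} where
  open TemporalPath

  orientPath : TemporalPath strictPaths lab u v → TemporalPath strictPaths (orientLabels lab) u v
  orientPath P = retime P
    (λ i → tagged (times P i) (orientation (verts P (inject₁ i)) (verts P (sucF i))))
    (λ i → ∈-map⁺ _ (labelled P i))
    (λ i j i<j → tagged-mono-< _ _ (ordered P i j i<j))

  unorientPath : TemporalPath strictPaths (orientLabels lab) u v → TemporalPath nonStrictPaths lab u v
  unorientPath Q = retime Q (λ i → proj₁ (decode i)) (λ i → proj₁ (proj₂ (decode i))) decoded-ordered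
    where
    decode : ∀ i → Σ ℕ λ t → t ∈ lab (verts Q (inject₁ i)) (verts Q (sucF i)) ×
                              times Q i ≡ tagged t (orientation (verts Q (inject₁ i)) (verts Q (sucF i)))
    decode i = ∈-map⁻ _ (labelled Q i)

    decoded-ordered : ∀ i j → i <ᶠ j → proj₁ (decode i) ≤ proj₁ (decode j)
    decoded-ordered i j i<j = tagged-cancel-< _ _
      (subst₂ _<_ (proj₂ (proj₂ (decode i))) (proj₂ (proj₂ (decode j))) (ordered Q i j i<j))

  -- Consecutive edges share a vertex but are different edges, so properness separates their labels.
  proper⇒strict : IsProperU lab → TemporalPath nonStrictPaths lab u v → TemporalPath strictPaths lab u v
  proper⇒strict properLab P = retime P (times P) (labelled P)
    (nondecreasing⇒increasing (times P) (ordered P) consecutive-≢)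
    where
    consecutive-≢ : ∀ m → times P (inject₁ m) ≢ times P (sucF m)
    consecutive-≢ m same = properLab _ _ _ _ _ (labelled P (inject₁ m))
      (subst (_∈ _) (sym same) (labelled P (sucF m))) (inj₂ (inj₂ (inj₁ refl))) distinctEdges
      where
      distinctEdges : ¬ ((verts P (inject₁ (inject₁ m)) ≡ verts P (sucF (inject₁ m)) × _)
                         ⊎ (verts P (inject₁ (inject₁ m)) ≡ verts P (sucF (sucF m)) × _))
      distinctEdges (inj₁ (e , _)) = <⇒≢ (≤̄⇒inject₁< ≤ᶠ-refl) (distinct P e)
      distinctEdges (inj₂ (e , _)) = <⇒≢ (<-trans (≤̄⇒inject₁< ≤ᶠ-refl) (≤̄⇒inject₁< ≤ᶠ-refl)) (distinct P e)

asDirected : ∀ {n} → UTG n → DTG n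
asDirected G = record { lab = lab G ; noLoops = noLoops G }

orient : ∀ {n} → UTG n → DTG n
orient G = record { lab = orientLabels (lab G) ; noLoops = λ u → cong (map _) (noLoops G u) }

samePaths⇒reachEquiv : ∀ x {n} (G : UTG n) (D : DTG n) →
  (∀ u v → TemporalPath (pathKind x) (lab G) u v ⇔ TemporalPath (pathKind x) (lab D) u v) →
  ReachEquiv x G D
samePaths⇒reachEquiv x G D paths = ↔-id _ , λ u v → mk⇔
  (λ (u≢v , P) → u≢v , Equivalence.to (paths u v) P)
  (λ (u≢v , Q) → u≢v , Equivalence.from (paths u v) Q)

asDirected-reachEquiv : ∀ x {n} (G : UTG n) → ReachEquiv x G (asDirected G)
asDirected-reachEquiv x G = samePaths⇒reachEquiv x G (asDirected G) (λ _ _ → ⇔-id _)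

orient-reachEquiv : ∀ {n} (G : UTG n) → IsProperU (lab G) → ReachEquiv proper G (orient G)
orient-reachEquiv G properLab = samePaths⇒reachEquiv proper G (orient G)
  (λ _ _ → mk⇔ orientPath (proper⇒strict properLab ∘′ unorientPath))

undirected⇒directed : ∀ x {n} (G : UTG n) → InSettingU x G → Σ (DTG n) λ D → InSettingD x D × ReachEquiv x G D
undirected⇒directed strict          G inX = asDirected G , inX , asDirected-reachEquiv strict G
undirected⇒directed strictSimple    G inX = asDirected G , inX , asDirected-reachEquiv strictSimple G
undirected⇒directed nonStrict       G inX = asDirected G , inX , asDirected-reachEquiv nonStrict G
undirected⇒directed nonStrictSimple G inX = asDirected G , inX , asDirected-reachEquiv nonStrictSimple G
undirected⇒directed proper          G properLab =
  orient G , orientLabels-proper properLab , orient-reachEquiv G properLab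
undirected⇒directed properSimple    G (properLab , simple) =
  orient G , (orientLabels-proper properLab , orientLabels-simple simple) , orient-reachEquiv G properLab

pattern 1F = sucF 0F

edge⇒path : ∀ {n σ} {lab : Labelling n} {a b t} → a ≢ b → t ∈ lab a b → TemporalPath σ lab a b
edge⇒path {a = a} {b} {t} a≢b t∈ab = record
  { k = 0 ; verts = ends ; times = λ _ → t ; distinct = ends-injective ; start = refl ; end = refl
  ; labelled = λ { 0F → t∈ab } ; ordered = λ { 0F 0F () } }
  where
  ends : Fin 2 → _
  ends 0F = a
  ends 1F = b

  ends-injective : ∀ {i j} → ends i ≡ ends j → i ≡ j
  ends-injective {0F} {0F} _   = refl
  ends-injective {0F} {1F} a≡b = contradiction a≡b a≢b
  ends-injective {1F} {0F} b≡a = contradiction (sym b≡a) a≢b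
  ends-injective {1F} {1F} _   = refl

Fin2-≢⇒≡ : ∀ {u v w : Fin 2} → v ≢ u → w ≢ u → v ≡ w
Fin2-≢⇒≡ {0F} {0F}      v≢u _   = contradiction refl v≢u
Fin2-≢⇒≡ {0F} {1F} {0F} _   w≢u = contradiction refl w≢u
Fin2-≢⇒≡ {0F} {1F} {1F} _   _   = refl
Fin2-≢⇒≡ {1F} {1F}      v≢u _   = contradiction refl v≢u
Fin2-≢⇒≡ {1F} {0F} {0F} _   _   = refl
Fin2-≢⇒≡ {1F} {0F} {1F} _   w≢u = contradiction refl w≢u

-- On two vertices a path is a single edge, which an undirected graph lets us traverse backwards.
reachU-symmetric-on-Fin2 : ∀ x (G : UTG 2) → Symmetric (ReachU x G)
reachU-symmetric-on-Fin2 x G {u} {v} (u≢v , P) = v≢u , edge⇒path v≢u t∈vu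
  where
  open TemporalPath P
  v≢u : v ≢ u
  v≢u = u≢v ∘′ sym

  second≡v : verts 1F ≡ v
  second≡v = Fin2-≢⇒≡ (λ second≡u → case distinct (trans second≡u (sym start)) of λ ()) v≢u

  t∈vu : times 0F ∈ lab G v u
  t∈vu = subst (times 0F ∈_) (symm G u v)
           (subst₂ (λ a b → times 0F ∈ lab G a b) start second≡v (labelled 0F))

isomorphic-symmetric : ∀ {n} {R S : Fin n → Fin n → Set} → Isomorphic R S → Symmetric R → Symmetric S
isomorphic-symmetric {S = S} (f , R⇔S) symR {a} {b} Sab =
  subst₂ S (strictlyInverseˡ b) (strictlyInverseˡ a)
    (Equivalence.to (R⇔S _ _) (symR (Equivalence.from (R⇔S _ _)
      (subst₂ S (sym (strictlyInverseˡ a)) (sym (strictlyInverseˡ b)) Sab))))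
  where open Inverse f

arcLabels : Labelling 2
arcLabels 0F 1F = 1 ∷ []
arcLabels _  _  = []

oneArc : DTG 2
oneArc = record { lab = arcLabels ; noLoops = λ { 0F → refl ; 1F → refl } }

∈-arcLabels : ∀ {a b t} → t ∈ arcLabels a b → a ≡ 0F × b ≡ 1F × t ≡ 1
∈-arcLabels {0F} {1F} (here refl) = refl , refl , refl
∈-arcLabels {0F} {1F} (there ())
∈-arcLabels {0F} {0F} ()
∈-arcLabels {1F}      ()

arcLabels-simple : IsSimple arcLabels
arcLabels-simple _ _ _ _ s∈ t∈ with ∈-arcLabels s∈ | ∈-arcLabels t∈
... | _ , _ , refl | _ , _ , refl = refl

arcLabels-proper : IsProperD arcLabels
arcLabels-proper _ _ _ _ _ t∈ab t∈cd _ distinctArcs with ∈-arcLabels t∈ab | ∈-arcLabels t∈cd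
... | refl , refl , _ | refl , refl , _ = distinctArcs (refl , refl)

oneArc-inSetting : ∀ x → InSettingD x oneArc
oneArc-inSetting strict          = _
oneArc-inSetting strictSimple    = arcLabels-simple
oneArc-inSetting nonStrict       = _
oneArc-inSetting nonStrictSimple = arcLabels-simple
oneArc-inSetting proper          = arcLabels-proper
oneArc-inSetting properSimple    = arcLabels-proper , arcLabels-simple

oneArc-reach : ∀ x → ReachD x oneArc 0F 1F
oneArc-reach x = (λ ()) , edge⇒path (λ ()) (here refl)

oneArc-¬reach : ∀ x → ¬ ReachD x oneArc 1F 0F
oneArc-¬reach x (_ , P) = case trans (sym first≡0) start of λ ()
  where
  open TemporalPath P
  first≡0 : verts 0F ≡ 0F
  first≡0 = proj₁ (∈-arcLabels (labelled 0F))

oneArc-¬reachEquiv : ∀ x (G : UTG 2) → ¬ ReachEquiv x G oneArc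
oneArc-¬reachEquiv x G equiv =
  oneArc-¬reach x (isomorphic-symmetric {S = ReachD x oneArc} equiv (reachU-symmetric-on-Fin2 x G) (oneArc-reach x))

mainTheorem14 : (x : Setting) →
    ((n : ℕ) (G : UTG n) → InSettingU x G →
      Σ (DTG n) (λ D → InSettingD x D × ReachEquiv x G D))
    × Σ ℕ (λ n → Σ (DTG n) (λ D → InSettingD x D ×
      ((G : UTG n) → InSettingU x G → ¬ ReachEquiv x G D)))
mainTheorem14 x =
  (λ n → undirected⇒directed x) ,
  (2 , oneArc , oneArc-inSetting x , λ G _ → oneArc-¬reachEquiv x G)
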